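{- Let $p$ be a prime and $d\geq 1$. Then $\mathcal{H}_{p,d}(x)$ is a least-degree monic null polynomial modulo $p^d$; that is, $\mathcal{H}_{p,d}(x)$ is a monic null polynomial modulo $p^d$ and its degree equals $\omega_1(p^d)$.
   Context: An integer polynomial $f$ is a null polynomial modulo $m$ if $f(x)\equiv 0 \pmod m$ for every integer $x$. A monic null polynomial of degree $n$ modulo $m$ is a null polynomial modulo $m$ that is coefficientwise congruent modulo $m$ to a monic polynomial of degree $n$. $\omega_1(m)$ denotes the least integer $n\geq 1$ such that a monic null polynomial of degree $n$ modulo $m$ exists. For a prime $p$ set $I_p(0)=0$ and $I_p(n)=\frac{p^n-1}{p-1}$ for $n\geq 1$. Define integer polynomials $\mathcal{G}_{p,0}(x)=x$ and $\mathcal{G}_{p,n}(x)=\prod_{i=0}^{p-1}\left(\mathcal{G}_{p,n-1}(x)-ip^{I_p(n-1)}\right)$ for $n\geq 1$ (so $\mathcal{G}_{p,1}(x)=x(x-1)\cdots(x-(p-1))$). Define exponent sequences $(e_{d,i})_{i\geq 1}$ for $d\geq 0$ recursively: $e_{0,i}=0$ for all $i$; for $d\geq 1$, if $\max_i e_{d-1,i}\leq p-1$ then $e_{d,1}=e_{d-1,1}+1$ and $e_{d,i}=e_{d-1,i}$ for $i\geq 2$; otherwise there is an index $i$ with $e_{d-1,i}=p$ and $e_{d-1,1}=\cdots=e_{d-1,i-1}=0$, and then $e_{d,i}=0$, $e_{d,i+1}=e_{d-1,i+1}+1$, and $e_{d,k}=e_{d-1,k}$ for all other $k$. Finally $\mathcal{H}_{p,d}(x)=\prod_{i\geq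 1}(\mathcal{G}_{p,i}(x))^{e_{d,i}}$ (a finite product). -}

module Defs where

open import Data.Nat as ℕ using (ℕ; zero; suc; _≤_; _<_; _∸_; _≟_; _≤?_)
open import Data.Integer as ℤ using (ℤ; +_; _-_)
open import Data.Integer.Divisibility using (_∣_)
open import Data.List using (List; []; _∷_; foldr)
open import Data.Bool using (Bool; true; false; if_then_else_)
open import Data.Product using (Σ; _×_)
open import Relation.Binary.PropositionalEquality using (_≡_)
open import Relation.Nullary.Decidable using (does)

-- Integer polynomials as coefficient lists (constant term first).

Poly : Set
Poly = List ℤ

coeff : Poly → ℕ → ℤ
coeff []       _       = + 0
coeff (c ∷ _)  zero    = c
coeff (_ ∷ cs) (suc k) = coeff cs k

eval : Poly → ℤ → ℤ
eval f x = foldr (λ c acc → c ℤ.+ x ℤ.* acc) (+ 0) f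

_⊕_ : Poly → Poly → Poly
[]       ⊕ g        = g
f        ⊕ []       = f
(a ∷ as) ⊕ (b ∷ bs) = (a ℤ.+ b) ∷ (as ⊕ bs)

scale : ℤ → Poly → Poly
scale c []       = []
scale c (a ∷ as) = (c ℤ.* a) ∷ scale c as

_⊗_ : Poly → Poly → Poly
[]       ⊗ g = []
(a ∷ as) ⊗ g = scale a g ⊕ (+ 0 ∷ (as ⊗ g))

one : Poly
one = + 1 ∷ []

X : Poly
X = + 0 ∷ + 1 ∷ []

_⊖const_ : Poly → ℤ → Poly
f ⊖const c = f ⊕ (ℤ.- c ∷ [])

_^ₚ_ : Poly → ℕ → Poly
f ^ₚ zero  = one
f ^ₚ suc n = f ⊗ (f ^ₚ n)

IsNull : ℕ → Poly → Set
IsNull m f = ∀ (x : ℤ) → (+ m) ∣ eval f x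

IsMonicOfDegree : Poly → ℕ → Set
IsMonicOfDegree g n = coeff g n ≡ + 1 × (∀ k → n < k → coeff g k ≡ + 0)

CongrMod : ℕ → Poly → Poly → Set
CongrMod m f g = ∀ k → (+ m) ∣ (coeff f k - coeff g k)

IsMonicNullOfDegree : ℕ → Poly → ℕ → Set
IsMonicNullOfDegree m f n =
  IsNull m f × Σ Poly (λ g → IsMonicOfDegree g n × CongrMod m f g)

HasMonicNullOfDegree : ℕ → ℕ → Set
HasMonicNullOfDegree m n = Σ Poly (λ f → IsMonicNullOfDegree m f n)

IsOmega1 : ℕ → ℕ → Set
IsOmega1 m n = 1 ≤ n × HasMonicNullOfDegree m n
             × (∀ k → 1 ≤ k → HasMonicNullOfDegree m k → n ≤ k)

-- I_p(n) = (p^n - 1)/(p - 1) for n ≥ 1, I_p(0) = 0,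
-- written as the geometric sum 1 + p + ... + p^(n-1).

I : ℕ → ℕ → ℕ
I p zero    = 0
I p (suc n) = p ℕ.^ n ℕ.+ I p n

prodShift : Poly → ℤ → ℕ → Poly
prodShift h c zero    = one
prodShift h c (suc k) = prodShift h c k ⊗ (h ⊖const ((+ k) ℤ.* c))

G : ℕ → ℕ → Poly
G p zero    = X
G p (suc n) = prodShift (G p n) (+ (p ℕ.^ I p n)) p

-- Exponent sequences e_{d,i}: represented by a finite list whose j-th
-- entry (j = 0,1,...) is e_{d,j+1}; entries beyond the list are 0.

incHead : List ℕ → List ℕ
incHead []       = 1 ∷ []
incHead (x ∷ xs) = suc x ∷ xs

carry : ℕ → List ℕ → List ℕ
carry p []       = []
carry p (x ∷ xs) = if does (x ≟ p) then 0 ∷ incHead xs else x ∷ carry p xs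

allLe : ℕ → List ℕ → Bool
allLe b []       = true
allLe b (x ∷ xs) = if does (x ≤? b) then allLe b xs else false

step : ℕ → List ℕ → List ℕ
step p es = if allLe (p ∸ 1) es then incHead es else carry p es

E : ℕ → ℕ → List ℕ
E p zero    = []
E p (suc d) = step p (E p d)

-- e_{d,i} (i ≥ 1); e p d 0 is unused
e : ℕ → ℕ → ℕ → ℕ
e p d i = lookup0 (E p d) i
  where
  lookup0 : List ℕ → ℕ → ℕ
  lookup0 []       _             = 0
  lookup0 (x ∷ _)  (suc zero)    = x
  lookup0 (_ ∷ xs) (suc (suc k)) = lookup0 xs (suc k)
  lookup0 _        zero          = 0

prodG : ℕ → ℕ → List ℕ → Poly
prodG p i []       = one
prodG p i (x ∷ xs) = (G p i ^ₚ x) ⊗ prodG p (suc i) xs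

H : ℕ → ℕ → Poly
H p d = prodG p 1 (E p d)

module Submission where

-- By induction, G p (i + 1) evaluated at an integer x is c ^ p · y (y − 1) ⋯ (y − p + 1), where
-- G p i (x) = c · y and c = p ^ I p i; since p divides a product of p consecutive integers,
-- p ^ I p (i + 1) divides G p (i + 1) (x). Hence H p d = ∏ G p i ^ e_{d,i} is monic of degree
-- n = Σ e_{d,i} p ^ i and null modulo p ^ (Σ e_{d,i} I p i) = p ^ d.
-- Conversely, the k-th finite difference of a monic polynomial of degree k is k!, so a monic null
-- polynomial of degree k modulo m forces m ∣ k!. Write n_d for the degree of H p d. If all digits
-- e_{d−1,i} are below p, then 0, e_{d−1,1}, e_{d−1,2}, … are the base-p digits of n_{d−1}, so by
-- Legendre's formula v_p(n_{d−1}!) = Σ e_{d−1,i} I p i = d − 1; the step to d adds p to n_{d−1},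
-- and v_p((n_{d−1} + p − 1)!) is still d − 1. Otherwise the step is a carry, which leaves n unchanged.
-- Either way p ^ d ∤ k! for k < n_d, by induction on d.

open import Defs
open import Data.Nat as ℕ using (ℕ; zero; suc; _≤_; _<_; _^_; _!; NonZero; z≤n; s≤s)
import Data.Nat.Properties as ℕP
open import Data.List using (List; []; _∷_)
open import Data.Product using (Σ; ∃; _×_; _,_; proj₂)
open import Data.Sum using (_⊎_; inj₁; inj₂)
open import Data.Empty using (⊥-elim)
open import Relation.Binary.PropositionalEquality

module IntegerPolynomials where

  open import Data.Integer as ℤ using (ℤ; +_; _-_; -_; _+_; _*_; -1ℤ)
  import Data.Integer.Properties as ℤP
  open import Data.Integer.DivMod using (_%ℕ_; _/ℕ_; a≡a%ℕn+[a/ℕn]*n; n%ℕd<d)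
  open import Data.Integer.Divisibility.Signed
    using (_∣_; divides; ∣-trans; ∣m∣n⇒∣m-n; ∣m∣n⇒∣m+n; ∣n⇒∣m*n; ∣m⇒∣m*n; *-monoˡ-∣; *-monoʳ-∣
          ; ∣ᵤ⇒∣; ∣⇒∣ᵤ)
  open import Data.Integer.Tactic.RingSolver using (solve-∀)
  open import Data.Nat.Tactic.RingSolver using () renaming (solve-∀ to ℕ-solve)
  import Data.Nat.Divisibility as ℕ

  eval-one : ∀ x → eval one x ≡ + 1
  eval-one x = cong (λ z → + 1 + z) (ℤP.*-zeroʳ x)

  eval-⊕ : ∀ f g x → eval (f ⊕ g) x ≡ eval f x + eval g x
  eval-⊕ []       g        x = sym (ℤP.+-identityˡ _)
  eval-⊕ (a ∷ as) []       x = sym (ℤP.+-identityʳ _)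
  eval-⊕ (a ∷ as) (b ∷ bs) x rewrite eval-⊕ as bs x = ring a b x (eval as x) (eval bs x)
    where
    ring : ∀ a b x u v → (a + b) + x * (u + v) ≡ (a + x * u) + (b + x * v)
    ring = solve-∀

  eval-scale : ∀ c f x → eval (scale c f) x ≡ c * eval f x
  eval-scale c []       x = sym (ℤP.*-zeroʳ c)
  eval-scale c (a ∷ as) x rewrite eval-scale c as x = ring c a x (eval as x)
    where
    ring : ∀ c a x u → c * a + x * (c * u) ≡ c * (a + x * u)
    ring = solve-∀

  eval-⊗ : ∀ f g x → eval (f ⊗ g) x ≡ eval f x * eval g x
  eval-⊗ []       g x = refl
  eval-⊗ (a ∷ as) g x
    rewrite eval-⊕ (scale a g) (+ 0 ∷ (as ⊗ g)) x | eval-scale a g x | eval-⊗ as g x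
    = ring a x (eval as x) (eval g x)
    where
    ring : ∀ a x u v → a * v + (+ 0 + x * (u * v)) ≡ (a + x * u) * v
    ring = solve-∀

  eval-⊖const : ∀ f c x → eval (f ⊖const c) x ≡ eval f x - c
  eval-⊖const f c x rewrite eval-⊕ f (- c ∷ []) x = ring (eval f x) c x
    where
    ring : ∀ u c x → u + (- c + x * + 0) ≡ u - c
    ring = solve-∀

  coeff-⊕ : ∀ f g k → coeff (f ⊕ g) k ≡ coeff f k + coeff g k
  coeff-⊕ []       g        k       = sym (ℤP.+-identityˡ _)
  coeff-⊕ (a ∷ as) []       zero    = sym (ℤP.+-identityʳ _)
  coeff-⊕ (a ∷ as) []       (suc k) = sym (ℤP.+-identityʳ _)
  coeff-⊕ (a ∷ as) (b ∷ bs) zero    = refl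
  coeff-⊕ (a ∷ as) (b ∷ bs) (suc k) = coeff-⊕ as bs k

  coeff-scale : ∀ c f k → coeff (scale c f) k ≡ c * coeff f k
  coeff-scale c []       k       = sym (ℤP.*-zeroʳ c)
  coeff-scale c (a ∷ as) zero    = refl
  coeff-scale c (a ∷ as) (suc k) = coeff-scale c as k

  VanishesFrom : ℕ → Poly → Set
  VanishesFrom n f = ∀ k → n ≤ k → coeff f k ≡ + 0

  vanishesFrom-mono : ∀ {m n} f → m ≤ n → VanishesFrom m f → VanishesFrom n f
  vanishesFrom-mono f m≤n v k n≤k = v k (ℕP.≤-trans m≤n n≤k)

  vanishesFrom-scale : ∀ {n} c f → VanishesFrom n f → VanishesFrom n (scale c f)
  vanishesFrom-scale c f v k n≤k = trans (coeff-scale c f k) (trans (cong (c *_) (v k n≤k)) (ℤP.*-zeroʳ c))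

  vanishesFrom0-∷ : ∀ f → VanishesFrom 0 f → VanishesFrom 0 (+ 0 ∷ f)
  vanishesFrom0-∷ f v zero    _ = refl
  vanishesFrom0-∷ f v (suc k) _ = v k z≤n

  vanishesFrom0-⊗ : ∀ f g → VanishesFrom 0 f → VanishesFrom 0 (f ⊗ g)
  vanishesFrom0-⊗ []       g v k _ = refl
  vanishesFrom0-⊗ (a ∷ as) g v k _ = begin
    coeff (scale a g ⊕ (+ 0 ∷ (as ⊗ g))) k    ≡⟨ coeff-⊕ (scale a g) (+ 0 ∷ (as ⊗ g)) k ⟩
    coeff (scale a g) k + coeff (+ 0 ∷ (as ⊗ g)) k
      ≡⟨ cong₂ _+_ (trans (coeff-scale a g k)
                          (trans (cong (_* coeff g k) (v 0 z≤n)) (ℤP.*-zeroˡ (coeff g k))))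
                   (vanishesFrom0-∷ (as ⊗ g) (vanishesFrom0-⊗ as g (λ j _ → v (suc j) z≤n)) k z≤n) ⟩
    + 0                                       ∎
    where open ≡-Reasoning

  monic-agree : ∀ {n} f g → (∀ k → n ≤ k → coeff g k ≡ coeff f k) →
                IsMonicOfDegree f n → IsMonicOfDegree g n
  monic-agree f g agree (lead , tail) =
    trans (agree _ ℕP.≤-refl) lead , λ k n<k → trans (agree k (ℕP.<⇒≤ n<k)) (tail k n<k)

  monic-⊕ˡ : ∀ {n} h f → VanishesFrom n h → IsMonicOfDegree f n → IsMonicOfDegree (h ⊕ f) n
  monic-⊕ˡ h f v = monic-agree f (h ⊕ f) λ k n≤k →
    trans (coeff-⊕ h f k) (trans (cong (_+ coeff f k) (v k n≤k)) (ℤP.+-identityˡ _))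

  monic-⊕ʳ : ∀ {n} f h → IsMonicOfDegree f n → VanishesFrom n h → IsMonicOfDegree (f ⊕ h) n
  monic-⊕ʳ f h m v = monic-agree f (f ⊕ h) (λ k n≤k →
    trans (coeff-⊕ f h k) (trans (cong (λ z → coeff f k + z) (v k n≤k)) (ℤP.+-identityʳ _))) m

  monic-∷ : ∀ {n} a f → IsMonicOfDegree f n → IsMonicOfDegree (a ∷ f) (suc n)
  monic-∷ a f (lead , tail) = lead , λ { (suc k) (s≤s n<k) → tail k n<k }

  monic-tail : ∀ {n a f} → IsMonicOfDegree (a ∷ f) (suc n) → IsMonicOfDegree f n
  monic-tail (lead , tail) = lead , λ k n<k → tail (suc k) (s≤s n<k)

  monic-⊗ : ∀ {m n} f g → IsMonicOfDegree f m → IsMonicOfDegree g n → IsMonicOfDegree (f ⊗ g) (m ℕ.+ n)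
  monic-⊗         []       g (() , _)
  monic-⊗ {zero} {n} (a ∷ as) g (refl , tail) mg = monic-⊕ʳ (scale (+ 1) g) (+ 0 ∷ (as ⊗ g)) g-monic rest-vanishes
    where
    g-monic : IsMonicOfDegree (scale (+ 1) g) n
    g-monic = monic-agree g (scale (+ 1) g) (λ k _ → trans (coeff-scale (+ 1) g k) (ℤP.*-identityˡ _)) mg
    rest-vanishes : VanishesFrom n (+ 0 ∷ (as ⊗ g))
    rest-vanishes = vanishesFrom-mono (+ 0 ∷ (as ⊗ g)) z≤n
      (vanishesFrom0-∷ (as ⊗ g) (vanishesFrom0-⊗ as g (λ k _ → tail (suc k) (s≤s z≤n))))
  monic-⊗ {suc m} {n} (a ∷ as) g mf mg =
    monic-⊕ˡ (scale a g) (+ 0 ∷ (as ⊗ g)) ag-vanishes (monic-∷ (+ 0) (as ⊗ g) (monic-⊗ as g (monic-tail mf) mg))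
    where
    ag-vanishes : VanishesFrom (suc (m ℕ.+ n)) (scale a g)
    ag-vanishes = vanishesFrom-mono (scale a g) (s≤s (ℕP.m≤n+m n m)) (vanishesFrom-scale a g (proj₂ mg))

  monic-⊖const : ∀ {n} .{{_ : NonZero n}} f c → IsMonicOfDegree f n → IsMonicOfDegree (f ⊖const c) n
  monic-⊖const {suc n} f c = monic-agree f (f ⊖const c) λ where
    (suc k) _ → trans (coeff-⊕ f (- c ∷ []) (suc k)) (ℤP.+-identityʳ _)

  monic-one : IsMonicOfDegree one 0
  monic-one = refl , λ { (suc k) _ → refl }

  monic-X : IsMonicOfDegree X 1
  monic-X = refl , λ { (suc zero) (s≤s ()) ; (suc (suc k)) _ → refl }

  monic-^ : ∀ {n} f k → IsMonicOfDegree f n → IsMonicOfDegree (f ^ₚ k) (k ℕ.* n)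
  monic-^ f zero    m = monic-one
  monic-^ f (suc k) m = monic-⊗ f (f ^ₚ k) m (monic-^ f k m)

  -- Finite differences

  Δ : ℕ → (ℤ → ℤ) → ℤ → ℤ
  Δ zero    f x = f x
  Δ (suc n) f x = Δ n f (x + + 1) - Δ n f x

  Δ-+ : ∀ n f g x → Δ n (λ y → f y + g y) x ≡ Δ n f x + Δ n g x
  Δ-+ zero    f g x = refl
  Δ-+ (suc n) f g x rewrite Δ-+ n f g (x + + 1) | Δ-+ n f g x =
    ring (Δ n f (x + + 1)) (Δ n g (x + + 1)) (Δ n f x) (Δ n g x)
    where
    ring : ∀ a b c d → (a + b) - (c + d) ≡ (a - c) + (b - d)
    ring = solve-∀

  Δ-const : ∀ n a x → Δ (suc n) (λ _ → a) x ≡ + 0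
  Δ-const zero    a x = ℤP.+-inverseʳ a
  Δ-const (suc n) a x rewrite Δ-const n a (x + + 1) | Δ-const n a x = refl

  Δ-x* : ∀ k h x → Δ (suc k) (λ y → y * h y) x ≡ x * Δ (suc k) h x + + suc k * Δ k h (x + + 1)
  Δ-x* zero    h x = ring x (h (x + + 1)) (h x)
    where
    ring : ∀ x a b → (x + + 1) * a - x * b ≡ x * (a - b) + + 1 * a
    ring = solve-∀
  Δ-x* (suc k) h x rewrite Δ-x* k h (x + + 1) | Δ-x* k h x | ℤP.pos-+ 1 (suc k) =
    ring x (Δ k h (x + + 1 + + 1)) (Δ k h (x + + 1)) (Δ (suc k) h x) (+ suc k)
    where
    ring : ∀ x a b c K → ((x + + 1) * (a - b) + K * a) - (x * c + K * b)
                       ≡ x * ((a - b) - c) + (+ 1 + K) * (a - b)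
    ring = solve-∀

  vanishesFrom0-eval : ∀ f x → VanishesFrom 0 f → eval f x ≡ + 0
  vanishesFrom0-eval []       x v = refl
  vanishesFrom0-eval (a ∷ as) x v rewrite v 0 z≤n | vanishesFrom0-eval as x (λ k _ → v (suc k) z≤n) =
    cong (λ z → + 0 + z) (ℤP.*-zeroʳ x)

  Δ-eval : ∀ f k → VanishesFrom (suc k) f → ∀ x → Δ k (eval f) x ≡ coeff f k * + (k !)
  Δ-eval []       zero    v x = refl
  Δ-eval []       (suc k) v x = Δ-const k (+ 0) x
  Δ-eval (a ∷ as) zero    v x rewrite vanishesFrom0-eval as x (λ k _ → v (suc k) (s≤s z≤n)) =
    trans (cong (λ z → a + z) (ℤP.*-zeroʳ x)) (trans (ℤP.+-identityʳ a) (sym (ℤP.*-identityʳ a)))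
  Δ-eval (a ∷ as) (suc k) v x = begin
    Δ (suc k) (λ y → a + y * eval as y) x
      ≡⟨ Δ-+ (suc k) (λ _ → a) (λ y → y * eval as y) x ⟩
    Δ (suc k) (λ _ → a) x + Δ (suc k) (λ y → y * eval as y) x
      ≡⟨ cong₂ _+_ (Δ-const k a x) (Δ-x* k (eval as) x) ⟩
    + 0 + (x * Δ (suc k) (eval as) x + + suc k * Δ k (eval as) (x + + 1))
      ≡⟨ cong (λ z → + 0 + (x * z + + suc k * Δ k (eval as) (x + + 1))) top-vanishes ⟩
    + 0 + (x * + 0 + + suc k * Δ k (eval as) (x + + 1))
      ≡⟨ cong (λ z → + 0 + (x * + 0 + + suc k * z)) (ih (x + + 1)) ⟩
    + 0 + (x * + 0 + + suc k * (coeff as k * + (k !)))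
      ≡⟨ ring x (+ suc k) (coeff as k) (+ (k !)) ⟩
    coeff as k * (+ suc k * + (k !))
      ≡⟨ cong (coeff as k *_) (sym (ℤP.pos-* (suc k) (k !))) ⟩
    coeff as k * + (suc k ℕ.! ) ∎
    where
    open ≡-Reasoning
    ih : ∀ y → Δ k (eval as) y ≡ coeff as k * + (k !)
    ih = Δ-eval as k (λ j k<j → v (suc j) (s≤s k<j))
    top-vanishes : Δ (suc k) (eval as) x ≡ + 0
    top-vanishes rewrite ih (x + + 1) | ih x = ℤP.+-inverseʳ (coeff as k * + (k !))
    ring : ∀ x K c F → + 0 + (x * + 0 + K * (c * F)) ≡ c * (K * F)
    ring = solve-∀

  Δ-∣ : ∀ {m} f → (∀ x → m ∣ f x) → ∀ n x → m ∣ Δ n f x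
  Δ-∣ f m∣f zero    x = m∣f x
  Δ-∣ f m∣f (suc n) x = ∣m∣n⇒∣m-n (Δ-∣ f m∣f n (x + + 1)) (Δ-∣ f m∣f n x)

  eval-∣ : ∀ {m} f x → (∀ k → m ∣ coeff f k) → m ∣ eval f x
  eval-∣ []       x m∣f = divides (+ 0) refl
  eval-∣ (a ∷ as) x m∣f = ∣m∣n⇒∣m+n (m∣f 0) (∣n⇒∣m*n x (eval-∣ as x (λ k → m∣f (suc k))))

  eval-congruent : ∀ {m} f g x → (∀ k → m ∣ coeff f k - coeff g k) → m ∣ eval f x - eval g x
  eval-congruent {m} f g x f≡g = subst (m ∣_) eval-diff (eval-∣ (f ⊕ scale -1ℤ g) x coeff-diff)
    where
    minus : ∀ a b → a + -1ℤ * b ≡ a - b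
    minus = solve-∀
    eval-diff : eval (f ⊕ scale -1ℤ g) x ≡ eval f x - eval g x
    eval-diff = trans (eval-⊕ f (scale -1ℤ g) x)
                      (trans (cong (λ z → eval f x + z) (eval-scale -1ℤ g x)) (minus (eval f x) (eval g x)))
    coeff-diff : ∀ k → m ∣ coeff (f ⊕ scale -1ℤ g) k
    coeff-diff k = subst (m ∣_) (sym (trans (coeff-⊕ f (scale -1ℤ g) k)
                     (trans (cong (λ z → coeff f k + z) (coeff-scale -1ℤ g k)) (minus (coeff f k) (coeff g k)))))
                     (f≡g k)

  hasMonicNull⇒∣! : ∀ m k → HasMonicNullOfDegree m k → m ℕ.∣ k !
  hasMonicNull⇒∣! m k (f , f-null , g , (lead , tail) , f≡g) =
    ∣⇒∣ᵤ (subst (+ m ∣_) kth-difference (Δ-∣ (eval g) g-null k (+ 0)))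
    where
    g-null : ∀ x → + m ∣ eval g x
    g-null x = subst (+ m ∣_) (ring (eval f x) (eval g x))
      (∣m∣n⇒∣m-n (∣ᵤ⇒∣ {+ m} {eval f x} (f-null x))
                 (eval-congruent f g x (λ j → ∣ᵤ⇒∣ (f≡g j))))
      where
      ring : ∀ a b → a - (a - b) ≡ b
      ring = solve-∀
    kth-difference : Δ k (eval g) (+ 0) ≡ + (k !)
    kth-difference = trans (Δ-eval g k tail (+ 0)) (trans (cong (_* + (k !)) lead) (ℤP.*-identityˡ _))

  null∧monic⇒monicNull : ∀ {m n} f → IsNull m f → IsMonicOfDegree f n → IsMonicNullOfDegree m f n
  null∧monic⇒monicNull {m} f f-null f-monic =
    f-null , f , f-monic , λ k → ∣⇒∣ᵤ {+ m} (divides (+ 0) (ℤP.+-inverseʳ (coeff f k)))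

  hasMonicNull⇒positive : ∀ {m k} → m ≢ 1 → HasMonicNullOfDegree m k → 1 ≤ k
  hasMonicNull⇒positive {m} {zero}  m≢1 f = ⊥-elim (m≢1 (ℕ.∣1⇒≡1 (hasMonicNull⇒∣! m 0 f)))
  hasMonicNull⇒positive {m} {suc k} _   _ = s≤s z≤n

  *-pres-∣ : ∀ {a b c d} → a ∣ b → c ∣ d → a * c ∣ b * d
  *-pres-∣ {b = b} {c} a∣b c∣d = ∣-trans (*-monoˡ-∣ c a∣b) (*-monoʳ-∣ b c∣d)

  falling : ℤ → ℕ → ℤ
  falling y zero    = + 1
  falling y (suc k) = falling y k * (y - + k)

  falling-∣ : ∀ {m} y r k → m ∣ y - + r → r < k → m ∣ falling y k
  falling-∣ y r (suc k) m∣y-r r<1+k with ℕP.m≤n⇒m<n∨m≡n (ℕP.≤-pred r<1+k)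
  ... | inj₁ r<k  = ∣m⇒∣m*n _ (falling-∣ y r k m∣y-r r<k)
  ... | inj₂ refl = ∣n⇒∣m*n (falling y r) m∣y-r

  p∣falling : ∀ p .{{_ : NonZero p}} y → + p ∣ falling y p
  p∣falling p y = falling-∣ y (y %ℕ p) p (divides (y /ℕ p) y-r≡q*p) (n%ℕd<d y p)
    where
    cancel : ∀ a b → (a + b) - a ≡ b
    cancel = solve-∀
    y-r≡q*p : y - + (y %ℕ p) ≡ (y /ℕ p) * + p
    y-r≡q*p = trans (cong (_- + (y %ℕ p)) (a≡a%ℕn+[a/ℕn]*n y p)) (cancel (+ (y %ℕ p)) ((y /ℕ p) * + p))

  eval-prodShift : ∀ h c y x k → eval h x ≡ y * + c →
                   eval (prodShift h (+ c) k) x ≡ + (c ^ k) * falling y k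
  eval-prodShift h c y x zero    h≡yc = eval-one x
  eval-prodShift h c y x (suc k) h≡yc = begin
    eval (prodShift h (+ c) k ⊗ (h ⊖const (+ k * + c))) x
      ≡⟨ eval-⊗ (prodShift h (+ c) k) (h ⊖const (+ k * + c)) x ⟩
    eval (prodShift h (+ c) k) x * eval (h ⊖const (+ k * + c)) x
      ≡⟨ cong₂ _*_ (eval-prodShift h c y x k h≡yc)
                   (trans (eval-⊖const h (+ k * + c) x) (cong (_- (+ k * + c)) h≡yc)) ⟩
    + (c ^ k) * falling y k * (y * + c - + k * + c)
      ≡⟨ ring (+ (c ^ k)) (falling y k) (+ c) y (+ k) ⟩
    + c * + (c ^ k) * falling y (suc k)
      ≡⟨ cong (_* falling y (suc k)) (sym (ℤP.pos-* c (c ^ k))) ⟩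
    + (c ^ suc k) * falling y (suc k) ∎
    where
    open ≡-Reasoning
    ring : ∀ a f c y k → a * f * (y * c - k * c) ≡ c * a * (f * (y - k))
    ring = solve-∀

  I-suc : ∀ p n → I p (suc n) ≡ I p n ℕ.* p ℕ.+ 1
  I-suc p zero    = refl
  I-suc p (suc n) = trans (cong (p ^ suc n ℕ.+_) (I-suc p n)) (ring (p ^ n) (I p n) p)
    where
    ring : ∀ a b p → p ℕ.* a ℕ.+ (b ℕ.* p ℕ.+ 1) ≡ (a ℕ.+ b) ℕ.* p ℕ.+ 1
    ring = ℕ-solve

  p^I∣G : ∀ p .{{_ : NonZero p}} n x → + (p ^ I p n) ∣ eval (G p n) x
  p^I∣G p zero    x = divides (eval X x) (sym (ℤP.*-identityʳ _))
  p^I∣G p (suc n) x with p^I∣G p n x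
  ... | divides y G≡y*c with p∣falling p y
  ...   | divides t falling≡t*p = divides t (begin
    eval (G p (suc n)) x       ≡⟨ eval-prodShift (G p n) c y x p G≡y*c ⟩
    + (c ^ p) * falling y p    ≡⟨ cong (+ (c ^ p) *_) falling≡t*p ⟩
    + (c ^ p) * (t * + p)      ≡⟨ ring (+ (c ^ p)) t (+ p) ⟩
    t * (+ (c ^ p) * + p)      ≡⟨ cong (t *_) (sym (ℤP.pos-* (c ^ p) p)) ⟩
    t * + (c ^ p ℕ.* p)        ≡⟨ cong (λ z → t * + z) exponent ⟩
    t * + (p ^ I p (suc n))    ∎)
    where
    open ≡-Reasoning
    c = p ^ I p n
    ring : ∀ a t b → a * (t * b) ≡ t * (a * b)
    ring = solve-∀
    exponent : c ^ p ℕ.* p ≡ p ^ I p (suc n)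
    exponent = begin
      (p ^ I p n) ^ p ℕ.* p       ≡⟨ cong (ℕ._* p) (ℕP.^-*-assoc p (I p n) p) ⟩
      p ^ (I p n ℕ.* p) ℕ.* p     ≡⟨ ℕP.*-comm (p ^ (I p n ℕ.* p)) p ⟩
      p ^ (1 ℕ.+ I p n ℕ.* p)     ≡⟨ cong (p ^_) (trans (ℕP.+-comm 1 _) (sym (I-suc p n))) ⟩
      p ^ I p (suc n)             ∎

  ^ₚ-∣ : ∀ {a} f x n → + a ∣ eval f x → + (a ^ n) ∣ eval (f ^ₚ n) x
  ^ₚ-∣ f x zero    a∣f = divides (+ 1) (eval-one x)
  ^ₚ-∣ {a} f x (suc n) a∣f rewrite eval-⊗ f (f ^ₚ n) x | ℤP.pos-* a (a ^ n) =
    *-pres-∣ a∣f (^ₚ-∣ f x n a∣f)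

  -- For es = e₁ ∷ e₂ ∷ …: weight p i es = Σⱼ eⱼ · I p (i + j − 1) and value p es = Σⱼ eⱼ · p ^ j.
  weight : ℕ → ℕ → List ℕ → ℕ
  weight p i []       = 0
  weight p i (e ∷ es) = I p i ℕ.* e ℕ.+ weight p (suc i) es

  value : ℕ → List ℕ → ℕ
  value p []       = 0
  value p (e ∷ es) = p ℕ.* (e ℕ.+ value p es)

  p^weight∣prodG : ∀ p .{{_ : NonZero p}} i es x → + (p ^ weight p i es) ∣ eval (prodG p i es) x
  p^weight∣prodG p i []       x = divides (+ 1) (eval-one x)
  p^weight∣prodG p i (e ∷ es) x
    rewrite eval-⊗ (G p i ^ₚ e) (prodG p (suc i) es) x
          | ℕP.^-distribˡ-+-* p (I p i ℕ.* e) (weight p (suc i) es)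
          | ℤP.pos-* (p ^ (I p i ℕ.* e)) (p ^ weight p (suc i) es)
          | sym (ℕP.^-*-assoc p (I p i) e)
    = *-pres-∣ (^ₚ-∣ (G p i) x e (p^I∣G p i x)) (p^weight∣prodG p (suc i) es x)

  prodG-null : ∀ p .{{_ : NonZero p}} i es → IsNull (p ^ weight p i es) (prodG p i es)
  prodG-null p i es x = ∣⇒∣ᵤ (p^weight∣prodG p i es x)

  monic-prodShift : ∀ {n} .{{_ : NonZero n}} h c k → IsMonicOfDegree h n →
                    IsMonicOfDegree (prodShift h c k) (k ℕ.* n)
  monic-prodShift h c zero    m = monic-one
  monic-prodShift {n} h c (suc k) m =
    subst (IsMonicOfDegree (prodShift h c (suc k))) (ℕP.+-comm (k ℕ.* n) n)
      (monic-⊗ (prodShift h c k) _ (monic-prodShift h c k m) (monic-⊖const h _ m))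

  monic-G : ∀ p .{{_ : NonZero p}} n → IsMonicOfDegree (G p n) (p ^ n)
  monic-G p zero    = monic-X
  monic-G p (suc n) = monic-prodShift {{ℕP.m^n≢0 p n}} (G p n) _ p (monic-G p n)

  monic-prodG : ∀ p .{{_ : NonZero p}} i es → IsMonicOfDegree (prodG p (suc i) es) (p ^ i ℕ.* value p es)
  monic-prodG p i []       = subst (IsMonicOfDegree one) (sym (ℕP.*-zeroʳ (p ^ i))) monic-one
  monic-prodG p i (e ∷ es) = subst (IsMonicOfDegree (prodG p (suc i) (e ∷ es))) (ring e p (p ^ i) (value p es))
    (monic-⊗ (G p (suc i) ^ₚ e) (prodG p (suc (suc i)) es)
      (monic-^ (G p (suc i)) e (monic-G p (suc i))) (monic-prodG p (suc i) es))
    where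
    ring : ∀ e p a v → e ℕ.* (p ℕ.* a) ℕ.+ p ℕ.* a ℕ.* v ≡ a ℕ.* (p ℕ.* (e ℕ.+ v))
    ring = ℕ-solve

open IntegerPolynomials

open import Data.Nat using (_+_; _*_; _∸_; pred; _≤?_; _≟_)
open import Data.Nat.Divisibility
  using (_∣_; _∤_; divides; ∣-trans; ∣-reflexive; ∣1⇒≡1; ∣⇒≤; ∣m+n∣m⇒∣n; n∣m*n; m∣m*n; *-cancelˡ-∣
        ; m≤n⇒m!∣n!)
open import Data.Nat.Primality using (Prime; euclidsLemma; prime⇒nonZero; prime⇒nonTrivial)
open import Data.Nat.Tactic.RingSolver using (solve-∀)
open import Data.List.Relation.Unary.All using (All; []; _∷_)
open import Data.Bool using (true; false; T)
open import Data.Unit using (tt)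
open import Relation.Nullary.Decidable using (dec-true; dec-false)
open import Relation.Binary.Bundles using (Preorder)
open import Relation.Binary.Structures using (IsPreorder)
import Relation.Binary.Reasoning.Preorder

data Admissible (p : ℕ) : List ℕ → Set where
  []  : Admissible p []
  _∷_ : ∀ {e es} → e < p → Admissible p es → Admissible p (e ∷ es)
  top : ∀ {es} → All (_< p) es → Admissible p (p ∷ es)

data Carry (p : ℕ) : List ℕ → List ℕ → Set where
  here  : ∀ es → Carry p (p ∷ es) (0 ∷ incHead es)
  there : ∀ {e es es′} → e < p → Carry p es es′ → Carry p (e ∷ es) (e ∷ es′)

module _ (p : ℕ) .{{_ : NonZero p}} where

  all<⇒admissible : ∀ {es} → All (_< p) es → Admissible p es
  all<⇒admissible []         = []
  all<⇒admissible (e<p ∷ es) = e<p ∷ all<⇒admissible es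

  ≤∷all<⇒admissible : ∀ {e es} → e ≤ p → All (_< p) es → Admissible p (e ∷ es)
  ≤∷all<⇒admissible e≤p es<p with ℕP.m≤n⇒m<n∨m≡n e≤p
  ... | inj₁ e<p  = e<p ∷ all<⇒admissible es<p
  ... | inj₂ refl = top es<p

  admissible-incHead : ∀ {es} → All (_< p) es → Admissible p (incHead es)
  admissible-incHead []         = ≤∷all<⇒admissible (ℕ.>-nonZero⁻¹ p) []
  admissible-incHead (e<p ∷ es) = ≤∷all<⇒admissible e<p es

  admissible-carry : ∀ {es es′} → Carry p es es′ → Admissible p es → Admissible p es′
  admissible-carry (here es)     (top es<p) = ℕ.>-nonZero⁻¹ p ∷ admissible-incHead es<p
  admissible-carry (here es)     (p<p ∷ _)  = ⊥-elim (ℕP.n≮n p p<p)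
  admissible-carry (there e<p c) (_ ∷ a)    = e<p ∷ admissible-carry c a
  admissible-carry (there p<p c) (top _)    = ⊥-elim (ℕP.n≮n p p<p)

  allLe-pred⇒all< : ∀ es → allLe (p ∸ 1) es ≡ true → All (_< p) es
  allLe-pred⇒all< []       _ = []
  allLe-pred⇒all< (e ∷ es) allLe≡true with e ℕ.≤ᵇ p ∸ 1 in e≤ᵇp-1
  ... | true = ℕP.m≤pred[n]⇒suc[m]≤n (ℕP.≤ᵇ⇒≤ e (p ∸ 1) (subst T (sym e≤ᵇp-1) tt))
               ∷ allLe-pred⇒all< es allLe≡true

  carry-finds-top : ∀ {es} → Admissible p es → allLe (p ∸ 1) es ≡ false → Carry p es (carry p es)
  carry-finds-top (top {es} _) _ rewrite dec-true (p ≟ p) refl = here es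
  carry-finds-top (_∷_ {e} e<p a) allLe≡false
    rewrite dec-true (e ≤? p ∸ 1) (ℕP.<⇒≤pred e<p) | dec-false (e ≟ p) (ℕP.<⇒≢ e<p) =
    there e<p (carry-finds-top a allLe≡false)

  step-elim : (P : List ℕ → Set) → ∀ {es} → Admissible p es →
              (All (_< p) es → P (incHead es)) → (Carry p es (carry p es) → P (carry p es)) →
              P (step p es)
  step-elim P {es} a increment carried with allLe (p ∸ 1) es in eq
  ... | true  = increment (allLe-pred⇒all< es eq)
  ... | false = carried (carry-finds-top a eq)

module _ (p : ℕ) where

  value-incHead : ∀ es → value p (incHead es) ≡ value p es + p
  value-incHead []       = ℕP.*-identityʳ p
  value-incHead (e ∷ es) = ring p e (value p es)
    where
    ring : ∀ p e v → p * (suc e + v) ≡ p * (e + v) + p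
    ring = solve-∀

  value-carry : ∀ {es es′} → Carry p es es′ → value p es′ ≡ value p es
  value-carry (here es)   = cong (p *_) (trans (value-incHead es) (ℕP.+-comm (value p es) p))
  value-carry (there {e} _ c) = cong (λ v → p * (e + v)) (value-carry c)

  weight-incHead : ∀ i es → weight p i (incHead es) ≡ weight p i es + I p i
  weight-incHead i []       = trans (ℕP.+-identityʳ _) (ℕP.*-identityʳ (I p i))
  weight-incHead i (e ∷ es) = ring (I p i) e (weight p (suc i) es)
    where
    ring : ∀ a e w → a * suc e + w ≡ a * e + w + a
    ring = solve-∀

  weight-shift : ∀ i es → weight p (suc (suc i)) es ≡ p ^ i * value p es + weight p (suc i) es
  weight-shift i []       = sym (cong (_+ 0) (ℕP.*-zeroʳ (p ^ i)))
  weight-shift i (e ∷ es) rewrite weight-shift (suc i) es =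
    ring p (p ^ i) (I p (suc i)) e (value p es) (weight p (suc (suc i)) es)
    where
    ring : ∀ p a b e v w → (p * a + b) * e + (p * a * v + w) ≡ a * (p * (e + v)) + (b * e + w)
    ring = solve-∀

  -- A carry trades p units of weight I p i for one unit of weight I p (i + 1) = p · I p i + 1.
  weight-carry : ∀ i {es es′} → Carry p es es′ → weight p i es′ ≡ suc (weight p i es)
  weight-carry i (here es) rewrite weight-incHead (suc i) es | I-suc p i =
    ring (I p i) (weight p (suc i) es) p
    where
    ring : ∀ a w p → a * 0 + (w + (a * p + 1)) ≡ suc (a * p + w)
    ring = solve-∀
  weight-carry i (there {e} {es} _ c) rewrite weight-carry (suc i) c = ℕP.+-suc (I p i * e) (weight p (suc i) es)

module _ (p : ℕ) .{{_ : NonZero p}} where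

  admissible-E : ∀ d → Admissible p (E p d)
  admissible-E zero    = []
  admissible-E (suc d) =
    step-elim p (Admissible p) (admissible-E d) (admissible-incHead p) (λ c → admissible-carry p c (admissible-E d))

  weight-E : ∀ d → weight p 1 (E p d) ≡ d
  weight-E zero    = refl
  weight-E (suc d) = step-elim p (λ es → weight p 1 es ≡ suc d) (admissible-E d)
    (λ _ → trans (weight-incHead p 1 (E p d)) (trans (ℕP.+-comm _ 1) (cong suc (weight-E d))))
    (λ c → trans (weight-carry p 1 c) (cong suc (weight-E d)))

  value-E-suc : ∀ d → All (_< p) (E p d) × value p (E p (suc d)) ≡ value p (E p d) + p
                    ⊎ value p (E p (suc d)) ≡ value p (E p d)
  value-E-suc d = step-elim p (λ es → All (_< p) (E p d) × value p es ≡ value p (E p d) + p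
                                     ⊎ value p es ≡ value p (E p d))
    (admissible-E d) (λ all< → inj₁ (all< , value-incHead p (E p d))) (λ c → inj₂ (value-carry p c))

-- p-adic valuations of factorials

module _ (p : ℕ) (p-prime : Prime p) where

  private instance
    p≢0 : NonZero p
    p≢0 = prime⇒nonZero p-prime

  pred[p]<p : pred p < p
  pred[p]<p = ℕP.m≤pred[n]⇒suc[m]≤n ℕP.≤-refl

  p∤1 : p ∤ 1
  p∤1 p∣1 = ℕ.nonTrivial⇒≢1 {{prime⇒nonTrivial p-prime}} (∣1⇒≡1 p∣1)

  infix 4 _≈ᵤ_
  _≈ᵤ_ : ℕ → ℕ → Set
  a ≈ᵤ b = ∃ λ u → b ≡ a * u × p ∤ u

  ≈ᵤ-reflexive : ∀ {a b} → a ≡ b → a ≈ᵤ b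
  ≈ᵤ-reflexive {a} refl = 1 , sym (ℕP.*-identityʳ a) , p∤1

  ≈ᵤ-trans : ∀ {a b c} → a ≈ᵤ b → b ≈ᵤ c → a ≈ᵤ c
  ≈ᵤ-trans {a} (u , refl , p∤u) (v , refl , p∤v) = u * v , ℕP.*-assoc a u v , p∤uv
    where
    p∤uv : p ∤ u * v
    p∤uv p∣uv with euclidsLemma u v p-prime p∣uv
    ... | inj₁ p∣u = p∤u p∣u
    ... | inj₂ p∣v = p∤v p∣v

  ≈ᵤ-isPreorder : IsPreorder _≡_ _≈ᵤ_
  ≈ᵤ-isPreorder = record
    { isEquivalence = isEquivalence
    ; reflexive     = λ {a} {b} → ≈ᵤ-reflexive {a} {b}
    ; trans         = λ {a} {b} {c} → ≈ᵤ-trans {a} {b} {c}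
    }

  ≈ᵤ-preorder : Preorder _ _ _
  ≈ᵤ-preorder = record { isPreorder = ≈ᵤ-isPreorder }

  ≈ᵤ-*ˡ : ∀ c {a b} → a ≈ᵤ b → c * a ≈ᵤ c * b
  ≈ᵤ-*ˡ c {a} (u , refl , p∤u) = u , sym (ℕP.*-assoc c a u) , p∤u

  ≈ᵤ-unit : ∀ {u} a → p ∤ u → a ≈ᵤ u * a
  ≈ᵤ-unit {u} a p∤u = u , ℕP.*-comm u a , p∤u

  ≈ᵤ⇒∤ : ∀ {v n} → p ^ v ≈ᵤ n → p ^ suc v ∤ n
  ≈ᵤ⇒∤ {v} (u , refl , p∤u) p^1+v∣n =
    p∤u (*-cancelˡ-∣ (p ^ v) {{ℕP.m^n≢0 p v}} (subst (_∣ p ^ v * u) (ℕP.*-comm p (p ^ v)) p^1+v∣n))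

  module ≈ᵤ-Reasoning = Relation.Binary.Reasoning.Preorder ≈ᵤ-preorder

  p∤[n+r] : ∀ {n r} → p ∣ n → 0 < r → r < p → p ∤ n + r
  p∤[n+r] {r = suc r} p∣n _ r<p p∣n+r = ℕP.<⇒≱ r<p (∣⇒≤ (∣m+n∣m⇒∣n p∣n+r p∣n))

  !-block : ∀ {n} r → p ∣ n → r < p → n ! ≈ᵤ (n + r) !
  !-block {n} zero    _   _   = ≈ᵤ-reflexive (cong _! (sym (ℕP.+-identityʳ n)))
  !-block {n} (suc r) p∣n r<p = begin
    n !                      ∼⟨ !-block r p∣n (ℕP.<-trans (ℕP.n<1+n r) r<p) ⟩
    (n + r) !                ∼⟨ ≈ᵤ-unit ((n + r) !) p∤1+n+r ⟩
    suc (n + r) * (n + r) !  ≡⟨ cong _! (sym (ℕP.+-suc n r)) ⟩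
    (n + suc r) !            ∎
    where
    open ≈ᵤ-Reasoning
    p∤1+n+r : p ∤ suc (n + r)
    p∤1+n+r = subst (p ∤_) (ℕP.+-suc n r) (p∤[n+r] p∣n ℕ.z<s r<p)

  !-p* : ∀ M → p ^ M * M ! ≈ᵤ (p * M) !
  !-p* zero    = ≈ᵤ-reflexive (cong _! (sym (ℕP.*-zeroʳ p)))
  !-p* (suc M) = begin
    p ^ suc M * suc M !                ≡⟨ ring p (p ^ M) M (M !) ⟩
    p * suc M * (p ^ M * M !)          ∼⟨ ≈ᵤ-*ˡ (p * suc M) (!-p* M) ⟩
    p * suc M * (p * M) !              ∼⟨ ≈ᵤ-*ˡ (p * suc M) (!-block (pred p) (m∣m*n M) pred[p]<p) ⟩
    p * suc M * (p * M + pred p) !     ≡⟨ cong (_* (p * M + pred p) !) last-factor ⟩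
    suc (p * M + pred p) * (p * M + pred p) ! ≡⟨ cong _! (sym last-factor) ⟩
    (p * suc M) !                      ∎
    where
    open ≈ᵤ-Reasoning
    ring : ∀ p a M F → p * a * (suc M * F) ≡ p * suc M * (a * F)
    ring = solve-∀
    last-factor : p * suc M ≡ suc (p * M + pred p)
    last-factor = trans (ℕP.*-suc p M)
      (trans (cong (_+ p * M) (sym (ℕP.suc-pred p))) (cong suc (ℕP.+-comm (pred p) (p * M))))

  p∣value : ∀ es → p ∣ value p es
  p∣value []       = divides 0 (sym (ℕP.*-zeroˡ p))
  p∣value (e ∷ es) = m∣m*n (e + value p es)

  -- Legendre's formula, for the number with base-p digits 0, e₁, e₂, …
  value-! : ∀ {es} → All (_< p) es → p ^ weight p 1 es ≈ᵤ (value p es) !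
  value-! {[]}     []           = ≈ᵤ-reflexive refl
  value-! {e ∷ es} (e<p ∷ es<p) = begin
    p ^ weight p 1 (e ∷ es)  ≡⟨ cong (p ^_) exponent ⟩
    p ^ (e + v + w)          ≡⟨ ℕP.^-distribˡ-+-* p (e + v) w ⟩
    p ^ (e + v) * p ^ w      ∼⟨ ≈ᵤ-*ˡ (p ^ (e + v)) (value-! es<p) ⟩
    p ^ (e + v) * v !        ∼⟨ ≈ᵤ-*ˡ (p ^ (e + v)) (!-block e (p∣value es) e<p) ⟩
    p ^ (e + v) * (v + e) !  ≡⟨ cong (λ n → p ^ (e + v) * n !) (ℕP.+-comm v e) ⟩
    p ^ (e + v) * (e + v) !  ∼⟨ !-p* (e + v) ⟩
    (p * (e + v)) !          ∎
    where
    open ≈ᵤ-Reasoning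
    v = value p es
    w = weight p 1 es
    ring : ∀ e v w → 1 * e + (1 * v + w) ≡ e + v + w
    ring = solve-∀
    exponent : weight p 1 (e ∷ es) ≡ e + v + w
    exponent = trans (cong (1 * e +_) (weight-shift p 0 es)) (ring e v w)

  all<⇒∤! : ∀ {es k} → All (_< p) es → k < value p es + p → p ^ suc (weight p 1 es) ∤ k !
  all<⇒∤! {es} {k} es<p k<v+p p^w+1∣k! =
    ≈ᵤ⇒∤ {weight p 1 es} p^w≈[v+p-1]! (∣-trans p^w+1∣k! (m≤n⇒m!∣n! k≤v+p-1))
    where
    p^w≈[v+p-1]! : p ^ weight p 1 es ≈ᵤ (value p es + pred p) !
    p^w≈[v+p-1]! = ≈ᵤ-trans {p ^ weight p 1 es} (value-! es<p) (!-block (pred p) (p∣value es) pred[p]<p)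
    k≤v+p-1 : k ≤ value p es + pred p
    k≤v+p-1 = ℕP.≤-pred (subst (k <_) v+p≡1+v+p-1 k<v+p)
      where
      v+p≡1+v+p-1 : value p es + p ≡ suc (value p es + pred p)
      v+p≡1+v+p-1 = trans (cong (value p es +_) (sym (ℕP.suc-pred p))) (ℕP.+-suc _ _)

  p^[1+d]≢1 : ∀ d → p ^ suc d ≢ 1
  p^[1+d]≢1 d p^[1+d]≡1 = p∤1 (∣-trans (m∣m*n (p ^ d)) (∣-reflexive p^[1+d]≡1))

  <value-E⇒∤! : ∀ d {k} → k < value p (E p d) → p ^ d ∤ k !
  <value-E⇒∤! zero    ()
  <value-E⇒∤! (suc d) {k} k<v with value-E-suc p d
  ... | inj₁ (all< , v≡v+p) = subst (λ w → p ^ suc w ∤ k !) (weight-E p d)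
                                (all<⇒∤! all< (subst (k <_) v≡v+p k<v))
  ... | inj₂ v≡v = λ p^[1+d]∣k! →
    <value-E⇒∤! d (subst (k <_) v≡v k<v) (∣-trans (n∣m*n p) p^[1+d]∣k!)

module _ (p : ℕ) .{{_ : NonZero p}} where

  H-monic : ∀ d → IsMonicOfDegree (H p d) (value p (E p d))
  H-monic d = subst (IsMonicOfDegree (H p d)) (ℕP.*-identityˡ _) (monic-prodG p 0 (E p d))

  H-null : ∀ d → IsNull (p ^ d) (H p d)
  H-null d = subst (λ w → IsNull (p ^ w) (H p d)) (weight-E p d) (prodG-null p 1 (E p d))

mainTheorem1 : (p d : ℕ) → Prime p → 1 ≤ d →
  Σ ℕ (λ n → IsMonicOfDegree (H p d) n
           × IsMonicNullOfDegree (p ^ d) (H p d) n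
           × IsOmega1 (p ^ d) n)
mainTheorem1 p zero    _       ()
mainTheorem1 p (suc d) p-prime _ =
  n , H-monic p (suc d) , H-monicNull , n-positive , H-hasMonicNull , n-least
  where
  instance
    p≢0 : NonZero p
    p≢0 = prime⇒nonZero p-prime
  n : ℕ
  n = value p (E p (suc d))
  H-monicNull : IsMonicNullOfDegree (p ^ suc d) (H p (suc d)) n
  H-monicNull = null∧monic⇒monicNull (H p (suc d)) (H-null p (suc d)) (H-monic p (suc d))
  H-hasMonicNull : HasMonicNullOfDegree (p ^ suc d) n
  H-hasMonicNull = H p (suc d) , H-monicNull
  n-positive : 1 ≤ n
  n-positive = hasMonicNull⇒positive (p^[1+d]≢1 p p-prime d) H-hasMonicNull
  n-least : ∀ k → 1 ≤ k → HasMonicNullOfDegree (p ^ suc d) k → n ≤ k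
  n-least k _ f = ℕP.≮⇒≥ λ k<n → <value-E⇒∤! p p-prime (suc d) k<n (hasMonicNull⇒∣! _ k f)
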